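{- Let $d$ be a positive integer, let $G=(V,E)$ be a graph, let $H=(V,F)$ be a maximal $d$-sparse spanning subgraph of $G$ (i.e. $H$ is $d$-sparse and $H+e$ is not $d$-sparse for every $e\in E\setminus F$), let $H_1,\dots,H_m$ be the $d$-critical components of $H$, and let $X_i$ be the vertex set of $H_i$. Then $\mathcal{X}=\{X_1,\dots,X_m\}$ is a $(d-1)$-thin cover of $G$, and every $(d-1)$-hinge of $\mathcal{X}$ is closed in $G$.
   Context: For $X\subseteq V$, $i_H(X)$ is the number of edges of $H$ with both ends in $X$. $H$ is $d$-sparse if $i_H(X)\le d|X|-\binom{d+1}{2}$ for all $X\subseteq V$ with $|X|\ge d$. A subgraph $(U,F')$ of a $d$-sparse graph $H$ is $d$-critical if either $|U|=2$ and $|F'|=1$, or $|U|\ge d+2$ and $|F'|=d|U|-\binom{d+1}{2}$; a $d$-critical component is a $d$-critical subgraph not properly contained in another $d$-critical subgraph. A family $\mathcal{X}$ of subsets of $V$ is a cover of $G$ if every set in $\mathcal{X}$ has at least two vertices and every edge of $G$ has both ends in some set of $\mathcal{X}$. It is $t$-thin if any two (distinct) sets of $\mathcal{X}$ intersect in at most $t$ vertices. A $k$-hinge of $\mathcal{X}$ is a set of $k$ vertices contained in the intersection of at least two sets of $\mathcal{X}$; a $k$-hinge $U$ is closed in $G$ if $G[U]$ is a complete graph. -}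

module Defs where

open import Data.Nat using (ℕ; zero; suc; _+_; _*_; _∸_; _≤_; _<ᵇ_)
open import Data.Nat.Combinatorics using (_C_)
open import Data.Bool using (Bool; true; false; _∧_; _∨_; if_then_else_)
open import Data.Fin using (Fin; toℕ; _≟_)
open import Data.Fin.Subset using (Subset; _∈_; _⊆_; ∣_∣; ⊤)
open import Data.Vec using (lookup)
open import Data.List using (List; map; allFin)
open import Data.Nat.ListAction using (sum)
open import Data.Product using (_×_; Σ; ∃)
open import Relation.Nullary using (¬_; does)
open import Relation.Binary.PropositionalEquality using (_≡_)

EdgeSet : ℕ → Set
EdgeSet n = Fin n → Fin n → Bool

record SimpleGraph (n : ℕ) : Set where
  field
    adj    : EdgeSet n
    sym    : ∀ i j → adj i j ≡ adj j i
    irrefl : ∀ i → adj i i ≡ false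
open SimpleGraph public

-- i_A(X): number of edges (unordered pairs {i,j}, counted once with i < j) of A with both ends in X.
iE : ∀ {n} → EdgeSet n → Subset n → ℕ
iE {n} A X = sum (map (λ i → sum (map (λ j →
    if (toℕ i <ᵇ toℕ j) ∧ lookup X i ∧ lookup X j ∧ A i j then 1 else 0)
    (allFin n))) (allFin n))

edgeCount : ∀ {n} → EdgeSet n → ℕ
edgeCount A = iE A ⊤

Sparse : ∀ {n} → ℕ → EdgeSet n → Set
Sparse d A = ∀ X → d ≤ ∣ X ∣ → iE A X ≤ d * ∣ X ∣ ∸ (suc d C 2)

addEdge : ∀ {n} → EdgeSet n → Fin n → Fin n → EdgeSet n
addEdge A u v i j = A i j ∨ (does (i ≟ u) ∧ does (j ≟ v)) ∨ (does (i ≟ v) ∧ does (j ≟ u))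

SpanningSubgraph : ∀ {n} → SimpleGraph n → SimpleGraph n → Set
SpanningSubgraph {n} H G = ∀ (i j : Fin n) → adj H i j ≡ true → adj G i j ≡ true

MaxSparseSpanning : ∀ {n} → ℕ → SimpleGraph n → SimpleGraph n → Set
MaxSparseSpanning {n} d H G =
  SpanningSubgraph H G × Sparse d (adj H) ×
  (∀ (u v : Fin n) → adj G u v ≡ true → adj H u v ≡ false → ¬ Sparse d (addEdge (adj H) u v))

record Subgraph {n : ℕ} (H : SimpleGraph n) : Set where
  field
    verts  : Subset n
    edges  : EdgeSet n
    esym   : ∀ i j → edges i j ≡ edges j i
    sub    : ∀ i j → edges i j ≡ true → adj H i j ≡ true
    inside : ∀ i j → edges i j ≡ true → (i ∈ verts) × (j ∈ verts)
open Subgraph public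

_⊑_ : ∀ {n} {H : SimpleGraph n} → Subgraph H → Subgraph H → Set
_⊑_ {n} S T = (verts S ⊆ verts T) × (∀ (i j : Fin n) → edges S i j ≡ true → edges T i j ≡ true)

Critical : ∀ {n} {H : SimpleGraph n} → ℕ → Subgraph H → Set
Critical d S =
  (∣ verts S ∣ ≡ 2 × edgeCount (edges S) ≡ 1) Data.Sum.⊎
  (suc (suc d) ≤ ∣ verts S ∣ × edgeCount (edges S) ≡ d * ∣ verts S ∣ ∸ (suc d C 2))
  where import Data.Sum

CriticalComponent : ∀ {n} {H : SimpleGraph n} → ℕ → Subgraph H → Set
CriticalComponent {n} {H} d S =
  Critical d S × (∀ (T : Subgraph H) → Critical d T → S ⊑ T → T ⊑ S)

Closed : ∀ {n} → SimpleGraph n → Subset n → Set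
Closed {n} G U = ∀ (u v : Fin n) → u ∈ U → v ∈ U → ¬ (u ≡ v) → adj G u v ≡ true

-- Write c = binom(d+1,2) and call a vertex set X tight when i_H(X) + c = d|X|, i.e. when the
-- sparsity count of H holds with equality.  Since i_H is supermodular and |X| is modular, the
-- union of two tight sets is tight as soon as their intersection satisfies the sparsity count.
-- Critical components are the induced subgraphs on maximal critical vertex sets, so two distinct
-- components never have a critical (= large enough tight) union.  If they shared d vertices the
-- intersection would be sparse, which gives (d-1)-thinness.  If they shared a (d-1)-set containing
-- a non-edge uv of H, that set has at most binom(d-1,2) - 1 edges, which is again enough; so every
-- (d-1)-hinge is complete in H, hence in G.  Finally an edge uv of G lies in a critical set: in
-- {u,v} if uv is an edge of H, and otherwise in a set X witnessing that H + uv is not sparse,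
-- which is tight in H, contains u and v, and has at least d+2 vertices because sets of size d or
-- d+1 can never violate sparsity.

module Submission where

open import Defs hiding (sym)
open import Data.Bool using (Bool; true; false; _∧_; _∨_; if_then_else_)
open import Data.Bool.Properties using (T-≡; ∧-comm; ∧-identityʳ; ∨-zeroʳ)
open import Data.Empty using (⊥-elim)
open import Data.Fin using (Fin; zero; suc; toℕ; _≟_)
open import Data.Fin.Properties using (toℕ-injective)
open import Data.Fin.Subset using (Subset; _∈_; _⊆_; _⊂_; _⊃_; _∩_; _∪_; ∣_∣; ⊤; ⁅_⁆; Empty)
open import Data.Fin.Subset.Properties using (p⊆p∪q; q⊆p∪q; x∈p∩q⁺; x∈p∩q⁻; x∈⁅x⁆; x∈⁅y⁆⇒x≡y;
  ∣⁅x⁆∣≡1; Empty-unique; ∣⊥∣≡0; p⊂q⇒∣p∣<∣q∣; p⊂q⇒p⊆q; ∣p∣≤n; anySubset?; _⊂?_; _∈?_; ⊆-refl;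
  ⊆-trans; ⊆-antisym; ∈⊤; ∣p∩q∣≤∣p∣; ∣p∩q∣≤∣q∣; ∣p∣≤∣p∪q∣; ∣q∣≤∣p∪q∣; p⊆q⇒∣p∣≤∣q∣)
open import Data.List using (map; allFin)
open import Data.List.Properties using (map-tabulate)
open import Data.Nat using (ℕ; zero; suc; _+_; _*_; _∸_; _≤_; _<_; _<ᵇ_; z≤n; s≤s; s≤s⁻¹; _≤?_)
open import Data.Nat.Combinatorics using (_C_; nC1≡n; nCk+nC[k+1]≡[n+1]C[k+1])
open import Data.Nat.Induction using (<-wellFounded)
open import Data.Nat.ListAction using (sum)
open import Data.Nat.Properties hiding (_≟_)
open import Data.Nat.Properties using () renaming (_≟_ to _≟ℕ_)
open import Algebra.Properties.CommutativeSemigroup +-commutativeSemigroup using (interchange; x∙yz≈y∙xz)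
open import Data.Nat.Tactic.RingSolver using (solve-∀)
open import Data.Product using (_×_; _,_; proj₁; proj₂; Σ; ∃-syntax)
open import Data.Sum using (_⊎_; inj₁; inj₂)
open import Data.Vec using (lookup; _∷_; [])
open import Data.Vec.Properties using ([]=⇒lookup; lookup⇒[]=)
open import Function using (id; _∘_; Equivalence)
open import Induction.WellFounded using (WellFounded; Acc; acc; module Subrelation)
import Relation.Binary.Construct.On as On
open import Relation.Binary.Definitions using (tri<; tri≈; tri>)
open import Relation.Binary.PropositionalEquality
open import Relation.Nullary using (¬_; does; yes; no; contradiction)
open import Relation.Nullary.Decidable using (dec-true; decidable-stable; _×-dec_; _⊎-dec_; ¬?)
open import Relation.Unary using (Pred; Decidable)

-- Finite sums and counting

∧-true⁻ : ∀ {a b} → a ∧ b ≡ true → a ≡ true × b ≡ true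
∧-true⁻ {true} b≡true = refl , b≡true

∧-true⁺ : ∀ {a b} → a ≡ true → b ≡ true → a ∧ b ≡ true
∧-true⁺ refl b≡true = b≡true

∨-true⁻ : ∀ {a b} → a ∨ b ≡ true → a ≡ true ⊎ b ≡ true
∨-true⁻ {true}  _        = inj₁ refl
∨-true⁻ {false} b≡true = inj₂ b≡true

≟-true⁻ : ∀ {n} {x y : Fin n} → does (x ≟ y) ≡ true → x ≡ y
≟-true⁻ {x = x} {y} e with x ≟ y | e
... | yes x≡y | _ = x≡y
... | no _    | ()

-- Written exactly like the sums in iE, so that iE unfolds to a double ∑.
∑ : ∀ {n} → (Fin n → ℕ) → ℕ
∑ {n} f = sum (map f (allFin n))

∑-suc : ∀ {n} (f : Fin (suc n) → ℕ) → ∑ f ≡ f zero + ∑ (f ∘ suc)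
∑-suc f = cong (λ xs → f zero + sum xs)
  (trans (map-tabulate suc f) (sym (map-tabulate id (f ∘ suc))))

∑-cong : ∀ {n} {f g : Fin n → ℕ} → (∀ i → f i ≡ g i) → ∑ f ≡ ∑ g
∑-cong {zero}  f≡g = refl
∑-cong {suc n} {f} {g} f≡g = begin
  ∑ f                  ≡⟨ ∑-suc f ⟩
  f zero + ∑ (f ∘ suc) ≡⟨ cong₂ _+_ (f≡g zero) (∑-cong (f≡g ∘ suc)) ⟩
  g zero + ∑ (g ∘ suc) ≡⟨ ∑-suc g ⟨
  ∑ g                  ∎
  where open ≡-Reasoning

∑-mono : ∀ {n} {f g : Fin n → ℕ} → (∀ i → f i ≤ g i) → ∑ f ≤ ∑ g
∑-mono {zero}  f≤g = z≤n
∑-mono {suc n} {f} {g} f≤g = begin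
  ∑ f                  ≡⟨ ∑-suc f ⟩
  f zero + ∑ (f ∘ suc) ≤⟨ +-mono-≤ (f≤g zero) (∑-mono (f≤g ∘ suc)) ⟩
  g zero + ∑ (g ∘ suc) ≡⟨ ∑-suc g ⟨
  ∑ g                  ∎
  where open ≤-Reasoning

∑-+ : ∀ {n} (f g : Fin n → ℕ) → ∑ (λ i → f i + g i) ≡ ∑ f + ∑ g
∑-+ {zero}  f g = refl
∑-+ {suc n} f g = begin
  ∑ (λ i → f i + g i)
    ≡⟨ ∑-suc (λ i → f i + g i) ⟩
  (f zero + g zero) + ∑ (λ i → f (suc i) + g (suc i))
    ≡⟨ cong (f zero + g zero +_) (∑-+ (f ∘ suc) (g ∘ suc)) ⟩
  (f zero + g zero) + (∑ (f ∘ suc) + ∑ (g ∘ suc))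
    ≡⟨ interchange (f zero) (g zero) _ _ ⟩
  (f zero + ∑ (f ∘ suc)) + (g zero + ∑ (g ∘ suc))
    ≡⟨ cong₂ _+_ (∑-suc f) (∑-suc g) ⟨
  ∑ f + ∑ g ∎
  where open ≡-Reasoning

∑-term : ∀ {n} (f : Fin n → ℕ) i → f i ≤ ∑ f
∑-term f zero    = ≤-trans (m≤m+n _ _) (≤-reflexive (sym (∑-suc f)))
∑-term f (suc i) = ≤-trans (∑-term (f ∘ suc) i) (≤-trans (m≤n+m _ _) (≤-reflexive (sym (∑-suc f))))

∑-zero : ∀ {n} → ∑ {n} (λ _ → 0) ≡ 0
∑-zero {zero}  = refl
∑-zero {suc n} = trans (∑-suc {n} (λ _ → 0)) (∑-zero {n})

𝟙 : Bool → ℕ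
𝟙 b = if b then 1 else 0

𝟙-mono : ∀ {a b} → (a ≡ true → b ≡ true) → 𝟙 a ≤ 𝟙 b
𝟙-mono {false} a⇒b = z≤n
𝟙-mono {true}  a⇒b rewrite a⇒b refl = ≤-refl

𝟙-∨-∧ : ∀ a b → 𝟙 (a ∨ b) + 𝟙 (a ∧ b) ≡ 𝟙 a + 𝟙 b
𝟙-∨-∧ false false = refl
𝟙-∨-∧ false true  = refl
𝟙-∨-∧ true  false = refl
𝟙-∨-∧ true  true  = refl

count : ∀ {n} → (Fin n → Fin n → Bool) → ℕ
count p = ∑ λ i → ∑ λ j → 𝟙 (p i j)

count-mono : ∀ {n} {p q : Fin n → Fin n → Bool} →
             (∀ i j → p i j ≡ true → q i j ≡ true) → count p ≤ count q
count-mono p⇒q = ∑-mono λ i → ∑-mono λ j → 𝟙-mono (p⇒q i j)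

count-∨-∧ : ∀ {n} (p q : Fin n → Fin n → Bool) →
            count (λ i j → p i j ∨ q i j) + count (λ i j → p i j ∧ q i j) ≡ count p + count q
count-∨-∧ p q = begin
  count (λ i j → p i j ∨ q i j) + count (λ i j → p i j ∧ q i j)
    ≡⟨ ∑-+ (λ i → ∑ λ j → 𝟙 (p i j ∨ q i j)) (λ i → ∑ λ j → 𝟙 (p i j ∧ q i j)) ⟨
  ∑ (λ i → ∑ (λ j → 𝟙 (p i j ∨ q i j)) + ∑ (λ j → 𝟙 (p i j ∧ q i j)))
    ≡⟨ ∑-cong row ⟩
  ∑ (λ i → ∑ (λ j → 𝟙 (p i j)) + ∑ (λ j → 𝟙 (q i j)))
    ≡⟨ ∑-+ (λ i → ∑ λ j → 𝟙 (p i j)) (λ i → ∑ λ j → 𝟙 (q i j)) ⟩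
  count p + count q ∎
  where
  open ≡-Reasoning
  row : ∀ i → ∑ (λ j → 𝟙 (p i j ∨ q i j)) + ∑ (λ j → 𝟙 (p i j ∧ q i j))
            ≡ ∑ (λ j → 𝟙 (p i j)) + ∑ (λ j → 𝟙 (q i j))
  row i = begin
    ∑ (λ j → 𝟙 (p i j ∨ q i j)) + ∑ (λ j → 𝟙 (p i j ∧ q i j)) ≡⟨ ∑-+ (λ j → 𝟙 (p i j ∨ q i j)) _ ⟨
    ∑ (λ j → 𝟙 (p i j ∨ q i j) + 𝟙 (p i j ∧ q i j))         ≡⟨ ∑-cong (λ j → 𝟙-∨-∧ (p i j) (q i j)) ⟩
    ∑ (λ j → 𝟙 (p i j) + 𝟙 (q i j))                         ≡⟨ ∑-+ (λ j → 𝟙 (p i j)) _ ⟩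
    ∑ (λ j → 𝟙 (p i j)) + ∑ (λ j → 𝟙 (q i j))               ∎

count-cong : ∀ {n} {p q : Fin n → Fin n → Bool} → (∀ i j → p i j ≡ q i j) → count p ≡ count q
count-cong p≡q = ∑-cong λ i → ∑-cong λ j → cong 𝟙 (p≡q i j)

count-term : ∀ {n} (p : Fin n → Fin n → Bool) i j → p i j ≡ true → 1 ≤ count p
count-term p i j pij = begin
  1                         ≡⟨ cong 𝟙 pij ⟨
  𝟙 (p i j)                 ≤⟨ ∑-term (λ j → 𝟙 (p i j)) j ⟩
  ∑ (λ j → 𝟙 (p i j))       ≤⟨ ∑-term (λ i → ∑ λ j → 𝟙 (p i j)) i ⟩
  count p                   ∎
  where open ≤-Reasoning

count-none : ∀ {n} {p : Fin n → Fin n → Bool} → (∀ i j → p i j ≢ true) → count p ≡ 0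
count-none {n} {p} ¬p = trans (∑-cong λ i → trans (∑-cong (𝟙-none i)) (∑-zero {n})) (∑-zero {n})
  where
  𝟙-none : ∀ i j → 𝟙 (p i j) ≡ 0
  𝟙-none i j with p i j in pij
  ... | false = refl
  ... | true  = ⊥-elim (¬p i j pij)

∣p∣≡∑ : ∀ {n} (p : Subset n) → ∣ p ∣ ≡ ∑ λ i → 𝟙 (lookup p i)
∣p∣≡∑ []          = refl
∣p∣≡∑ (true ∷ p)  = trans (cong suc (∣p∣≡∑ p)) (sym (∑-suc (λ i → 𝟙 (lookup (true ∷ p) i))))
∣p∣≡∑ (false ∷ p) = trans (∣p∣≡∑ p) (sym (∑-suc (λ i → 𝟙 (lookup (false ∷ p) i))))

∣p∪q∣+∣p∩q∣≡∣p∣+∣q∣ : ∀ {n} (p q : Subset n) → ∣ p ∪ q ∣ + ∣ p ∩ q ∣ ≡ ∣ p ∣ + ∣ q ∣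
∣p∪q∣+∣p∩q∣≡∣p∣+∣q∣ []          []          = refl
∣p∪q∣+∣p∩q∣≡∣p∣+∣q∣ (true ∷ p)  (true ∷ q)  =
  cong suc (trans (+-suc _ _) (trans (cong suc (∣p∪q∣+∣p∩q∣≡∣p∣+∣q∣ p q)) (sym (+-suc ∣ p ∣ ∣ q ∣))))
∣p∪q∣+∣p∩q∣≡∣p∣+∣q∣ (true ∷ p)  (false ∷ q) = cong suc (∣p∪q∣+∣p∩q∣≡∣p∣+∣q∣ p q)
∣p∪q∣+∣p∩q∣≡∣p∣+∣q∣ (false ∷ p) (true ∷ q)  =
  trans (cong suc (∣p∪q∣+∣p∩q∣≡∣p∣+∣q∣ p q)) (sym (+-suc ∣ p ∣ ∣ q ∣))
∣p∪q∣+∣p∩q∣≡∣p∣+∣q∣ (false ∷ p) (false ∷ q) = ∣p∪q∣+∣p∩q∣≡∣p∣+∣q∣ p q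

∣⁅x⁆∪⁅y⁆∣≡2 : ∀ {n} {x y : Fin n} → x ≢ y → ∣ ⁅ x ⁆ ∪ ⁅ y ⁆ ∣ ≡ 2
∣⁅x⁆∪⁅y⁆∣≡2 {n} {x} {y} x≢y = begin
  ∣ ⁅ x ⁆ ∪ ⁅ y ⁆ ∣                         ≡⟨ +-identityʳ _ ⟨
  ∣ ⁅ x ⁆ ∪ ⁅ y ⁆ ∣ + 0                     ≡⟨ cong (∣ ⁅ x ⁆ ∪ ⁅ y ⁆ ∣ +_) ∣x∩y∣≡0 ⟨
  ∣ ⁅ x ⁆ ∪ ⁅ y ⁆ ∣ + ∣ ⁅ x ⁆ ∩ ⁅ y ⁆ ∣       ≡⟨ ∣p∪q∣+∣p∩q∣≡∣p∣+∣q∣ ⁅ x ⁆ ⁅ y ⁆ ⟩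
  ∣ ⁅ x ⁆ ∣ + ∣ ⁅ y ⁆ ∣                      ≡⟨ cong₂ _+_ (∣⁅x⁆∣≡1 x) (∣⁅x⁆∣≡1 y) ⟩
  2                                        ∎
  where
  open ≡-Reasoning
  disjoint : Empty (⁅ x ⁆ ∩ ⁅ y ⁆)
  disjoint (z , z∈) = let z∈x , z∈y = x∈p∩q⁻ ⁅ x ⁆ ⁅ y ⁆ z∈
                      in  x≢y (trans (sym (x∈⁅y⁆⇒x≡y x z∈x)) (x∈⁅y⁆⇒x≡y y z∈y))
  ∣x∩y∣≡0 : ∣ ⁅ x ⁆ ∩ ⁅ y ⁆ ∣ ≡ 0
  ∣x∩y∣≡0 = trans (cong ∣_∣ (Empty-unique disjoint)) (∣⊥∣≡0 n)

x∈⁅x⁆∪⁅y⁆ : ∀ {n} (x y : Fin n) → x ∈ ⁅ x ⁆ ∪ ⁅ y ⁆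
x∈⁅x⁆∪⁅y⁆ x y = p⊆p∪q ⁅ y ⁆ (x∈⁅x⁆ x)

y∈⁅x⁆∪⁅y⁆ : ∀ {n} (x y : Fin n) → y ∈ ⁅ x ⁆ ∪ ⁅ y ⁆
y∈⁅x⁆∪⁅y⁆ x y = q⊆p∪q ⁅ x ⁆ ⁅ y ⁆ (x∈⁅x⁆ y)

-- Binomial arithmetic

C2-suc : ∀ m → suc m C 2 ≡ m + m C 2
C2-suc m = trans (sym (nCk+nC[k+1]≡[n+1]C[k+1] m 1)) (cong (_+ m C 2) (nC1≡n m))

C2+C2-suc : ∀ m → m C 2 + suc m C 2 ≡ m * m
C2+C2-suc zero    = refl
C2+C2-suc (suc m) = begin
  suc m C 2 + suc (suc m) C 2        ≡⟨ cong₂ _+_ (C2-suc m) (C2-suc (suc m)) ⟩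
  (m + c) + (suc m + suc m C 2)      ≡⟨ cong (λ x → (m + c) + (suc m + x)) (C2-suc m) ⟩
  (m + c) + (suc m + (m + c))        ≡⟨ regroup m c ⟩
  (suc m + m) + (c + (m + c))        ≡⟨ cong (λ x → (suc m + m) + (c + x)) (C2-suc m) ⟨
  (suc m + m) + (c + suc m C 2)      ≡⟨ cong ((suc m + m) +_) (C2+C2-suc m) ⟩
  (suc m + m) + m * m                ≡⟨ square m ⟩
  suc m * suc m                      ∎
  where
  open ≡-Reasoning
  c = m C 2
  regroup : ∀ m c → (m + c) + (suc m + (m + c)) ≡ (suc m + m) + (c + (m + c))
  regroup = solve-∀
  square : ∀ m → (suc m + m) + m * m ≡ suc m * suc m
  square = solve-∀

suc-C2≤* : ∀ {d k} → d ≤ k → suc d C 2 ≤ d * k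
suc-C2≤* {d} {k} d≤k = begin
  suc d C 2             ≤⟨ m≤n+m _ (d C 2) ⟩
  d C 2 + suc d C 2     ≡⟨ C2+C2-suc d ⟩
  d * d                 ≤⟨ *-monoʳ-≤ d d≤k ⟩
  d * k                 ∎
  where open ≤-Reasoning

C2+suc-C2≤* : ∀ {d k} → d ≤ k → k ≤ suc d → k C 2 + suc d C 2 ≤ d * k
C2+suc-C2≤* {d} {k} d≤k k≤1+d with m≤n⇒m<n∨m≡n d≤k
... | inj₂ refl = ≤-reflexive (C2+C2-suc d)
... | inj₁ d<k rewrite ≤-antisym k≤1+d d<k = ≤-reflexive (begin
  suc d C 2 + suc d C 2     ≡⟨ cong (_+ suc d C 2) (C2-suc d) ⟩
  (d + d C 2) + suc d C 2   ≡⟨ +-assoc d _ _ ⟩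
  d + (d C 2 + suc d C 2)   ≡⟨ cong (d +_) (C2+C2-suc d) ⟩
  d + d * d                 ≡⟨ *-suc d d ⟨
  d * suc d                 ∎)
  where open ≡-Reasoning

pred-C2+suc-C2 : ∀ e → e C 2 + suc (suc e) C 2 ≡ suc (suc e * e)
pred-C2+suc-C2 e = begin
  e C 2 + suc (suc e) C 2          ≡⟨ cong (e C 2 +_) (C2-suc (suc e)) ⟩
  e C 2 + (suc e + suc e C 2)      ≡⟨ x∙yz≈y∙xz (e C 2) (suc e) _ ⟩
  suc e + (e C 2 + suc e C 2)      ≡⟨ cong (suc e +_) (C2+C2-suc e) ⟩
  suc e + e * e                    ∎
  where open ≡-Reasoning

pred-C2-slack : ∀ {d i} → 1 ≤ d → suc i ≤ (d ∸ 1) C 2 → i + suc d C 2 ≤ d * (d ∸ 1)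
pred-C2-slack {suc e} {i} _ i<eC2 = s≤s⁻¹ (begin
  suc i + suc (suc e) C 2     ≤⟨ +-monoˡ-≤ (suc (suc e) C 2) i<eC2 ⟩
  e C 2 + suc (suc e) C 2     ≡⟨ pred-C2+suc-C2 e ⟩
  suc (suc e * e)             ∎)
  where open ≤-Reasoning

1+suc-C2≡*2 : ∀ {d} → 1 ≤ d → d ≤ 2 → 1 + suc d C 2 ≡ d * 2
1+suc-C2≡*2 {1} _ _ = refl
1+suc-C2≡*2 {2} _ _ = refl
1+suc-C2≡*2 {suc (suc (suc _))} _ (s≤s (s≤s ()))

pair-union-size : ∀ {m k d} → m + k ≡ 4 → 1 ≤ d → d ≤ k → k ≤ 2 → (m ≡ 2 × d ≤ 2) ⊎ suc (suc d) ≤ m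
pair-union-size {m} {1} {1} m+1≡4 _ _ _ = inj₂ (≤-reflexive (sym (+-cancelʳ-≡ 1 m 3 m+1≡4)))
pair-union-size {m} {2} {d} m+2≡4 _ d≤2 _ = inj₁ (+-cancelʳ-≡ 2 m 2 m+2≡4 , d≤2)
pair-union-size {k = 1} {suc (suc _)} _ _ (s≤s ()) _
pair-union-size {k = suc (suc (suc _))} _ _ _ (s≤s (s≤s ()))

-- Edges inside a vertex set

-- iE A X is definitionally count (edgeIn A X).
edgeIn : ∀ {n} → EdgeSet n → Subset n → Fin n → Fin n → Bool
edgeIn A X i j = (toℕ i <ᵇ toℕ j) ∧ lookup X i ∧ lookup X j ∧ A i j

module _ {n} (A : EdgeSet n) (X : Subset n) (i j : Fin n) where

  edgeIn⁻ : edgeIn A X i j ≡ true → toℕ i < toℕ j × i ∈ X × j ∈ X × A i j ≡ true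
  edgeIn⁻ e =
    let i<j , e₁ = ∧-true⁻ e ; i∈X , e₂ = ∧-true⁻ e₁ ; j∈X , Aij = ∧-true⁻ e₂
    in  <ᵇ⇒< (toℕ i) (toℕ j) (Equivalence.from T-≡ i<j) ,
        lookup⇒[]= i X i∈X , lookup⇒[]= j X j∈X , Aij

  edgeIn⁺ : toℕ i < toℕ j → i ∈ X → j ∈ X → A i j ≡ true → edgeIn A X i j ≡ true
  edgeIn⁺ i<j i∈X j∈X Aij =
    ∧-true⁺ (Equivalence.to T-≡ (<⇒<ᵇ i<j))
      (∧-true⁺ ([]=⇒lookup i∈X) (∧-true⁺ ([]=⇒lookup j∈X) Aij))

iE-mono : ∀ {n} (A B : EdgeSet n) (X Y : Subset n) →
          (∀ {i j} → i ∈ X → j ∈ X → A i j ≡ true → i ∈ Y × j ∈ Y × B i j ≡ true) →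
          iE A X ≤ iE B Y
iE-mono A B X Y A⇒B = count-mono {p = edgeIn A X} {edgeIn B Y} λ i j e →
  let i<j , i∈X , j∈X , Aij = edgeIn⁻ A X i j e ; i∈Y , j∈Y , Bij = A⇒B i∈X j∈X Aij
  in  edgeIn⁺ B Y i j i<j i∈Y j∈Y Bij

_∪ᴱ_ _∩ᴱ_ : ∀ {n} → EdgeSet n → EdgeSet n → EdgeSet n
(A ∪ᴱ B) i j = A i j ∨ B i j
(A ∩ᴱ B) i j = A i j ∧ B i j

iE-∪ᴱ-∩ᴱ : ∀ {n} (A B : EdgeSet n) X → iE (A ∪ᴱ B) X + iE (A ∩ᴱ B) X ≡ iE A X + iE B X
iE-∪ᴱ-∩ᴱ A B X = begin
  iE (A ∪ᴱ B) X + iE (A ∩ᴱ B) X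
    ≡⟨ cong₂ _+_ (count-cong (edgeIn-distrib _∨_ refl)) (count-cong (edgeIn-distrib _∧_ refl)) ⟩
  count (λ i j → edgeIn A X i j ∨ edgeIn B X i j) + count (λ i j → edgeIn A X i j ∧ edgeIn B X i j)
    ≡⟨ count-∨-∧ (edgeIn A X) (edgeIn B X) ⟩
  iE A X + iE B X ∎
  where
  open ≡-Reasoning
  edgeIn-distrib : (_⊕_ : Bool → Bool → Bool) → false ⊕ false ≡ false → ∀ i j →
    edgeIn (λ i j → A i j ⊕ B i j) X i j ≡ edgeIn A X i j ⊕ edgeIn B X i j
  edgeIn-distrib _⊕_ ff i j with toℕ i <ᵇ toℕ j | lookup X i | lookup X j
  ... | true  | true  | true  = refl
  ... | true  | true  | false = sym ff
  ... | true  | false | _     = sym ff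
  ... | false | _     | _     = sym ff

iE-supermodular : ∀ {n} (A : EdgeSet n) X Y → iE A X + iE A Y ≤ iE A (X ∪ Y) + iE A (X ∩ Y)
iE-supermodular A X Y = begin
  iE A X + iE A Y
    ≡⟨ count-∨-∧ (edgeIn A X) (edgeIn A Y) ⟨
  count (λ i j → edgeIn A X i j ∨ edgeIn A Y i j) + count (λ i j → edgeIn A X i j ∧ edgeIn A Y i j)
    ≤⟨ +-mono-≤ (count-mono {q = edgeIn A (X ∪ Y)} in-∪) (count-mono {q = edgeIn A (X ∩ Y)} in-∩) ⟩
  iE A (X ∪ Y) + iE A (X ∩ Y) ∎
  where
  open ≤-Reasoning
  in-∪ : ∀ i j → (edgeIn A X i j ∨ edgeIn A Y i j) ≡ true → edgeIn A (X ∪ Y) i j ≡ true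
  in-∪ i j e with ∨-true⁻ e
  ... | inj₁ eX = let i<j , i∈X , j∈X , Aij = edgeIn⁻ A X i j eX
                  in  edgeIn⁺ A (X ∪ Y) i j i<j (p⊆p∪q Y i∈X) (p⊆p∪q Y j∈X) Aij
  ... | inj₂ eY = let i<j , i∈Y , j∈Y , Aij = edgeIn⁻ A Y i j eY
                  in  edgeIn⁺ A (X ∪ Y) i j i<j (q⊆p∪q X Y i∈Y) (q⊆p∪q X Y j∈Y) Aij
  in-∩ : ∀ i j → (edgeIn A X i j ∧ edgeIn A Y i j) ≡ true → edgeIn A (X ∩ Y) i j ≡ true
  in-∩ i j e =
    let eX , eY = ∧-true⁻ e
        i<j , i∈X , j∈X , Aij = edgeIn⁻ A X i j eX
        _ , i∈Y , j∈Y , _ = edgeIn⁻ A Y i j eY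
    in  edgeIn⁺ A (X ∩ Y) i j i<j (x∈p∩q⁺ (i∈X , i∈Y)) (x∈p∩q⁺ (j∈X , j∈Y)) Aij

iE-∷ : ∀ {n} (A : EdgeSet (suc n)) x (X : Subset n) →
       iE A (x ∷ X) ≡ ∑ (λ j → 𝟙 (x ∧ lookup X j ∧ A zero (suc j))) + iE (λ i j → A (suc i) (suc j)) X
iE-∷ {n} A x X =
  trans (∑-suc (λ i → ∑ (row i))) (cong₂ _+_ (∑-suc (row zero)) (∑-cong λ i → ∑-suc (row (suc i))))
  where
  row : Fin (suc n) → Fin (suc n) → ℕ
  row i j = 𝟙 (edgeIn A (x ∷ X) i j)

iE-complete : ∀ {n} (X : Subset n) → iE (λ _ _ → true) X ≡ ∣ X ∣ C 2
iE-complete []          = refl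
iE-complete (true ∷ X)  = begin
  iE K (true ∷ X)                            ≡⟨ iE-∷ K true X ⟩
  ∑ (λ j → 𝟙 (lookup X j ∧ true)) + iE K X   ≡⟨ cong₂ _+_ (∑-cong λ j → cong 𝟙 (∧-identityʳ (lookup X j)))
                                                           (iE-complete X) ⟩
  ∑ (λ j → 𝟙 (lookup X j)) + ∣ X ∣ C 2         ≡⟨ cong (_+ ∣ X ∣ C 2) (∣p∣≡∑ X) ⟨
  ∣ X ∣ + ∣ X ∣ C 2                            ≡⟨ C2-suc ∣ X ∣ ⟨
  suc ∣ X ∣ C 2                                ∎
  where
  open ≡-Reasoning
  K : ∀ {n} → EdgeSet n
  K _ _ = true
iE-complete {suc n} (false ∷ X) =
  trans (iE-∷ (λ _ _ → true) false X) (cong₂ _+_ (∑-zero {n}) (iE-complete X))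

iE≤C2 : ∀ {n} (A : EdgeSet n) X → iE A X ≤ ∣ X ∣ C 2
iE≤C2 A X = ≤-trans (iE-mono A (λ _ _ → true) X X (λ i∈X j∈X _ → i∈X , j∈X , refl))
                    (≤-reflexive (iE-complete X))

edge⇒1≤iE : ∀ {n} {A : EdgeSet n} {X} {a b} → a ≢ b → a ∈ X → b ∈ X →
         A a b ≡ true → A b a ≡ true → 1 ≤ iE A X
edge⇒1≤iE {A = A} {X} {a} {b} a≢b a∈X b∈X Aab Aba with <-cmp (toℕ a) (toℕ b)
... | tri< a<b _ _ = count-term (edgeIn A X) a b (edgeIn⁺ A X a b a<b a∈X b∈X Aab)
... | tri≈ _ a≡b _ = ⊥-elim (a≢b (toℕ-injective a≡b))
... | tri> _ _ b<a = count-term (edgeIn A X) b a (edgeIn⁺ A X b a b<a b∈X a∈X Aba)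

-- addEdge A u v is definitionally A ∪ᴱ pairEdge u v.
pairEdge : ∀ {n} → Fin n → Fin n → EdgeSet n
pairEdge u v i j = does (i ≟ u) ∧ does (j ≟ v) ∨ does (i ≟ v) ∧ does (j ≟ u)

module _ {n} (u v : Fin n) where

  pairEdge⁻ : ∀ i j → pairEdge u v i j ≡ true → (i ≡ u × j ≡ v) ⊎ (i ≡ v × j ≡ u)
  pairEdge⁻ i j e with ∨-true⁻ e
  ... | inj₁ e₁ = let i≟u , j≟v = ∧-true⁻ e₁ in inj₁ (≟-true⁻ i≟u , ≟-true⁻ j≟v)
  ... | inj₂ e₂ = let i≟v , j≟u = ∧-true⁻ e₂ in inj₂ (≟-true⁻ i≟v , ≟-true⁻ j≟u)

  pairEdge-uv : pairEdge u v u v ≡ true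
  pairEdge-uv rewrite dec-true (u ≟ u) refl | dec-true (v ≟ v) refl = refl

  pairEdge-vu : pairEdge u v v u ≡ true
  pairEdge-vu rewrite dec-true (v ≟ v) refl | dec-true (u ≟ u) refl = ∨-zeroʳ _

module _ {n} {A : EdgeSet n} {u v : Fin n} where

  iE-addEdge-≤ : ∀ X → u ≢ v → iE (addEdge A u v) X ≤ iE A X + 1
  iE-addEdge-≤ X u≢v = begin
    iE (A ∪ᴱ P) X                   ≤⟨ m≤m+n _ _ ⟩
    iE (A ∪ᴱ P) X + iE (A ∩ᴱ P) X   ≡⟨ iE-∪ᴱ-∩ᴱ A P X ⟩
    iE A X + iE P X                 ≤⟨ +-monoʳ-≤ (iE A X) (iE-mono P P X (⁅ u ⁆ ∪ ⁅ v ⁆) ends) ⟩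
    iE A X + iE P (⁅ u ⁆ ∪ ⁅ v ⁆)   ≤⟨ +-monoʳ-≤ (iE A X) (iE≤C2 P (⁅ u ⁆ ∪ ⁅ v ⁆)) ⟩
    iE A X + ∣ ⁅ u ⁆ ∪ ⁅ v ⁆ ∣ C 2   ≡⟨ cong (λ k → iE A X + k C 2) (∣⁅x⁆∪⁅y⁆∣≡2 u≢v) ⟩
    iE A X + 1                      ∎
    where
    open ≤-Reasoning
    P = pairEdge u v
    ends : ∀ {i j} → i ∈ X → j ∈ X → P i j ≡ true → i ∈ ⁅ u ⁆ ∪ ⁅ v ⁆ × j ∈ ⁅ u ⁆ ∪ ⁅ v ⁆ × P i j ≡ true
    ends {i} {j} _ _ Pij with pairEdge⁻ u v i j Pij
    ... | inj₁ (refl , refl) = x∈⁅x⁆∪⁅y⁆ u v , y∈⁅x⁆∪⁅y⁆ u v , Pij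
    ... | inj₂ (refl , refl) = y∈⁅x⁆∪⁅y⁆ u v , x∈⁅x⁆∪⁅y⁆ u v , Pij

  iE-addEdge-outside : ∀ X → ¬ (u ∈ X × v ∈ X) → iE (addEdge A u v) X ≤ iE A X
  iE-addEdge-outside X out = iE-mono (A ∪ᴱ pairEdge u v) A X X old-edge
    where
    old-edge : ∀ {i j} → i ∈ X → j ∈ X → (A ∪ᴱ pairEdge u v) i j ≡ true → i ∈ X × j ∈ X × A i j ≡ true
    old-edge {i} {j} i∈X j∈X e with ∨-true⁻ e
    ... | inj₁ Aij = i∈X , j∈X , Aij
    ... | inj₂ Pij with pairEdge⁻ u v i j Pij
    ...   | inj₁ (refl , refl) = ⊥-elim (out (i∈X , j∈X))
    ...   | inj₂ (refl , refl) = ⊥-elim (out (j∈X , i∈X))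

  iE<C2 : ∀ X → u ≢ v → u ∈ X → v ∈ X → A u v ≡ false → A v u ≡ false → suc (iE A X) ≤ ∣ X ∣ C 2
  iE<C2 X u≢v u∈X v∈X ¬Auv ¬Avu = begin
    suc (iE A X)                    ≡⟨ +-comm 1 (iE A X) ⟩
    iE A X + 1                      ≤⟨ +-monoʳ-≤ (iE A X)
                                         (edge⇒1≤iE u≢v u∈X v∈X (pairEdge-uv u v) (pairEdge-vu u v)) ⟩
    iE A X + iE P X                 ≡⟨ iE-∪ᴱ-∩ᴱ A P X ⟨
    iE (A ∪ᴱ P) X + iE (A ∩ᴱ P) X   ≡⟨ cong (iE (A ∪ᴱ P) X +_) (count-none no-common-edge) ⟩
    iE (A ∪ᴱ P) X + 0               ≡⟨ +-identityʳ _ ⟩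
    iE (A ∪ᴱ P) X                   ≤⟨ iE≤C2 (A ∪ᴱ P) X ⟩
    ∣ X ∣ C 2                        ∎
    where
    open ≤-Reasoning
    P = pairEdge u v
    no-common-edge : ∀ i j → edgeIn (A ∩ᴱ P) X i j ≢ true
    no-common-edge i j e with edgeIn⁻ (A ∩ᴱ P) X i j e
    ... | _ , _ , _ , AP with ∧-true⁻ AP
    ...   | Aij , Pij with pairEdge⁻ u v i j Pij
    ...     | inj₁ (refl , refl) = contradiction (trans (sym Aij) ¬Auv) λ ()
    ...     | inj₂ (refl , refl) = contradiction (trans (sym Aij) ¬Avu) λ ()

-- Maximal subsets and sparsity

⊃-wellFounded : ∀ {n} → WellFounded (_⊃_ {n})
⊃-wellFounded {n} = Subrelation.wellFounded ⊃⇒∸< (On.wellFounded (λ X → n ∸ ∣ X ∣) <-wellFounded)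
  where
  ⊃⇒∸< : ∀ {Y X : Subset n} → Y ⊃ X → n ∸ ∣ Y ∣ < n ∸ ∣ X ∣
  ⊃⇒∸< {Y} X⊂Y = ∸-monoʳ-< (p⊂q⇒∣p∣<∣q∣ X⊂Y) (∣p∣≤n Y)

maximal-⊇ : ∀ {n ℓ} {P : Pred (Subset n) ℓ} → Decidable P → ∀ {X} → P X →
            ∃[ Y ] P Y × X ⊆ Y × (∀ {Z} → P Z → ¬ Y ⊂ Z)
maximal-⊇ {P = P} P? = go (⊃-wellFounded _)
  where
  go : ∀ {X} → Acc _⊃_ X → P X → ∃[ Y ] P Y × X ⊆ Y × (∀ {Z} → P Z → ¬ Y ⊂ Z)
  go {X} (acc larger) PX with anySubset? (λ Z → P? Z ×-dec X ⊂? Z)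
  ... | no ∄Z = X , PX , ⊆-refl , λ PZ X⊂Z → ∄Z (_ , PZ , X⊂Z)
  ... | yes (Z , PZ , X⊂Z) =
    let Y , PY , Z⊆Y , maxY = go (larger X⊂Z) PZ
    in  Y , PY , ⊆-trans (p⊂q⇒p⊆q X⊂Z) Z⊆Y , maxY

⊆∧⊄⇒⊇ : ∀ {n} {X Y : Subset n} → X ⊆ Y → ¬ X ⊂ Y → Y ⊆ X
⊆∧⊄⇒⊇ {X = X} X⊆Y X⊄Y {y} y∈Y with y ∈? X
... | yes y∈X = y∈X
... | no  y∉X = ⊥-elim (X⊄Y (X⊆Y , y , y∈Y , y∉X))

¬Sparse⇒overfull : ∀ {n} d (A : EdgeSet n) → ¬ Sparse d A →
                   ∃[ X ] d ≤ ∣ X ∣ × d * ∣ X ∣ ∸ suc d C 2 < iE A X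
¬Sparse⇒overfull d A ¬sparse
  with anySubset? (λ X → d ≤? ∣ X ∣ ×-dec ¬? (iE A X ≤? d * ∣ X ∣ ∸ suc d C 2))
... | yes (X , d≤∣X∣ , overfull) = X , d≤∣X∣ , ≰⇒> overfull
... | no  ∄X = ⊥-elim (¬sparse λ X d≤∣X∣ →
  decidable-stable (iE A X ≤? d * ∣ X ∣ ∸ suc d C 2) λ overfull → ∄X (X , d≤∣X∣ , overfull))

adj⇒≢ : ∀ {n} (G : SimpleGraph n) {u v} → adj G u v ≡ true → u ≢ v
adj⇒≢ G {u} uv refl with trans (sym uv) (irrefl G u)
... | ()

component-size : ∀ {n d} {H : SimpleGraph n} (S : Subgraph H) → CriticalComponent d S → 2 ≤ ∣ verts S ∣
component-size S (inj₁ (∣S∣≡2 , _) , _)   = ≤-reflexive (sym ∣S∣≡2)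
component-size S (inj₂ (d+2≤∣S∣ , _) , _) = ≤-trans (s≤s (s≤s z≤n)) d+2≤∣S∣

-- Critical sets of a d-sparse graph

module SparseGraph {n d} (1≤d : 1 ≤ d) (H : SimpleGraph n) (H-sparse : Sparse d (adj H)) where

  iH : Subset n → ℕ
  iH = iE (adj H)

  Tight : Subset n → Set
  Tight X = iH X + suc d C 2 ≡ d * ∣ X ∣

  CriticalSet : Subset n → Set
  CriticalSet X = (∣ X ∣ ≡ 2 × iH X ≡ 1) ⊎ (suc (suc d) ≤ ∣ X ∣ × Tight X)

  criticalSet? : Decidable CriticalSet
  criticalSet? X = (∣ X ∣ ≟ℕ 2 ×-dec iH X ≟ℕ 1)
             ⊎-dec (suc (suc d) ≤? ∣ X ∣ ×-dec iH X + suc d C 2 ≟ℕ d * ∣ X ∣)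

  sparse : ∀ X → d ≤ ∣ X ∣ → iH X + suc d C 2 ≤ d * ∣ X ∣
  sparse X d≤∣X∣ = begin
    iH X + suc d C 2                   ≤⟨ +-monoˡ-≤ (suc d C 2) (H-sparse X d≤∣X∣) ⟩
    d * ∣ X ∣ ∸ suc d C 2 + suc d C 2   ≡⟨ m∸n+n≡m (suc-C2≤* d≤∣X∣) ⟩
    d * ∣ X ∣                           ∎
    where open ≤-Reasoning

  edgeCount≤iH : (S : Subgraph H) → edgeCount (edges S) ≤ iH (verts S)
  edgeCount≤iH S = iE-mono (edges S) (adj H) ⊤ (verts S) λ _ _ e →
    let i∈S , j∈S = inside S _ _ e in i∈S , j∈S , sub S _ _ e

  critical⇒criticalSet : ∀ (S : Subgraph H) → Critical d S → CriticalSet (verts S)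
  critical⇒criticalSet S (inj₁ (∣S∣≡2 , one-edge)) = inj₁ (∣S∣≡2 , ≤-antisym at-most-one at-least-one)
    where
    at-most-one : iH (verts S) ≤ 1
    at-most-one = ≤-trans (iE≤C2 (adj H) (verts S)) (≤-reflexive (cong (_C 2) ∣S∣≡2))
    at-least-one : 1 ≤ iH (verts S)
    at-least-one = ≤-trans (≤-reflexive (sym one-edge)) (edgeCount≤iH S)
  critical⇒criticalSet S (inj₂ (d+2≤∣S∣ , full)) =
    inj₂ (d+2≤∣S∣ , ≤-antisym (sparse (verts S) d≤∣S∣) (begin
    d * ∣ verts S ∣                              ≡⟨ m∸n+n≡m (suc-C2≤* d≤∣S∣) ⟨
    d * ∣ verts S ∣ ∸ suc d C 2 + suc d C 2       ≡⟨ cong (_+ suc d C 2) full ⟨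
    edgeCount (edges S) + suc d C 2               ≤⟨ +-monoˡ-≤ (suc d C 2) (edgeCount≤iH S) ⟩
    iH (verts S) + suc d C 2                      ∎))
    where
    open ≤-Reasoning
    d≤∣S∣ = ≤-trans (m≤n+m d 2) d+2≤∣S∣

  induced : Subset n → Subgraph H
  induced X = record
    { verts  = X
    ; edges  = λ i j → adj H i j ∧ lookup X i ∧ lookup X j
    ; esym   = λ i j → cong₂ _∧_ (SimpleGraph.sym H i j) (∧-comm (lookup X i) (lookup X j))
    ; sub    = λ i j e → proj₁ (∧-true⁻ e)
    ; inside = λ i j e → let i∈X , j∈X = ∧-true⁻ (proj₂ (∧-true⁻ {adj H i j} e))
                         in  lookup⇒[]= i X i∈X , lookup⇒[]= j X j∈X
    }

  edgeCount-induced : ∀ X → edgeCount (edges (induced X)) ≡ iH X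
  edgeCount-induced X = ≤-antisym (edgeCount≤iH (induced X))
    (iE-mono (adj H) (edges (induced X)) X ⊤ λ i∈X j∈X Aij →
      ∈⊤ , ∈⊤ , ∧-true⁺ Aij (∧-true⁺ ([]=⇒lookup i∈X) ([]=⇒lookup j∈X)))

  criticalSet⇒critical : ∀ X → CriticalSet X → Critical d (induced X)
  criticalSet⇒critical X (inj₁ (∣X∣≡2 , one-edge)) = inj₁ (∣X∣≡2 , trans (edgeCount-induced X) one-edge)
  criticalSet⇒critical X (inj₂ (d+2≤∣X∣ , tight)) = inj₂ (d+2≤∣X∣ , (begin
    edgeCount (edges (induced X))        ≡⟨ edgeCount-induced X ⟩
    iH X                                 ≡⟨ m+n∸n≡m (iH X) (suc d C 2) ⟨
    iH X + suc d C 2 ∸ suc d C 2         ≡⟨ cong (_∸ suc d C 2) tight ⟩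
    d * ∣ X ∣ ∸ suc d C 2                 ∎))
    where open ≡-Reasoning

  ⊑-induced : ∀ (S : Subgraph H) {X} → verts S ⊆ X → S ⊑ induced X
  ⊑-induced S S⊆X = S⊆X , λ i j e → let i∈S , j∈S = inside S i j e in
    ∧-true⁺ (sub S i j e) (∧-true⁺ ([]=⇒lookup (S⊆X i∈S)) ([]=⇒lookup (S⊆X j∈S)))

  component-⊇ : ∀ (S : Subgraph H) X → CriticalComponent d S → CriticalSet X → verts S ⊆ X → X ⊆ verts S
  component-⊇ S X (_ , maximal) crit S⊆X =
    proj₁ (maximal (induced X) (criticalSet⇒critical X crit) (⊑-induced S S⊆X))

  components-merge : ∀ (S T : Subgraph H) → CriticalComponent d S → CriticalComponent d T →
                     CriticalSet (verts S ∪ verts T) → verts S ≡ verts T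
  components-merge S T compS compT crit = ⊆-antisym
    (λ x∈S → component-⊇ T (X ∪ Y) compT crit (q⊆p∪q X Y) (p⊆p∪q Y x∈S))
    (λ x∈T → component-⊇ S (X ∪ Y) compS crit (p⊆p∪q Y) (q⊆p∪q X Y x∈T))
    where
    X = verts S
    Y = verts T

  criticalSet⊆component : ∀ X → CriticalSet X → Σ (Subgraph H) λ S → CriticalComponent d S × X ⊆ verts S
  criticalSet⊆component X crit =
    let Y , critY , X⊆Y , maxY = maximal-⊇ criticalSet? {X} crit
        maximal : ∀ T → Critical d T → induced Y ⊑ T → T ⊑ induced Y
        maximal T critT (Y⊆T , _) = ⊑-induced T (⊆∧⊄⇒⊇ Y⊆T (maxY (critical⇒criticalSet T critT)))
    in  induced Y , (criticalSet⇒critical Y critY , maximal) , X⊆Y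

  tight-∪ : ∀ X Y → Tight X → Tight Y → iH (X ∩ Y) + suc d C 2 ≤ d * ∣ X ∩ Y ∣ → d ≤ ∣ X ∪ Y ∣ →
            Tight (X ∪ Y)
  tight-∪ X Y tightX tightY sparse-∩ d≤∣X∪Y∣ = ≤-antisym (sparse (X ∪ Y) d≤∣X∪Y∣)
    (+-cancelʳ-≤ (d * ∣ X ∩ Y ∣) (d * ∣ X ∪ Y ∣) (iH (X ∪ Y) + c) (begin
      d * ∣ X ∪ Y ∣ + d * ∣ X ∩ Y ∣          ≡⟨ *-distribˡ-+ d ∣ X ∪ Y ∣ ∣ X ∩ Y ∣ ⟨
      d * (∣ X ∪ Y ∣ + ∣ X ∩ Y ∣)            ≡⟨ cong (d *_) (∣p∪q∣+∣p∩q∣≡∣p∣+∣q∣ X Y) ⟩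
      d * (∣ X ∣ + ∣ Y ∣)                    ≡⟨ *-distribˡ-+ d ∣ X ∣ ∣ Y ∣ ⟩
      d * ∣ X ∣ + d * ∣ Y ∣                  ≡⟨ cong₂ _+_ tightX tightY ⟨
      (iH X + c) + (iH Y + c)              ≡⟨ interchange (iH X) c (iH Y) c ⟩
      (iH X + iH Y) + (c + c)              ≤⟨ +-monoˡ-≤ (c + c) (iE-supermodular (adj H) X Y) ⟩
      (iH (X ∪ Y) + iH (X ∩ Y)) + (c + c)  ≡⟨ interchange (iH (X ∪ Y)) (iH (X ∩ Y)) c c ⟩
      (iH (X ∪ Y) + c) + (iH (X ∩ Y) + c)  ≤⟨ +-monoʳ-≤ (iH (X ∪ Y) + c) sparse-∩ ⟩
      (iH (X ∪ Y) + c) + d * ∣ X ∩ Y ∣      ∎))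
    where
    open ≤-Reasoning
    c = suc d C 2

  criticalSet⇒tight : ∀ X → CriticalSet X → d ≤ ∣ X ∣ → Tight X
  criticalSet⇒tight X (inj₁ (∣X∣≡2 , one-edge)) d≤∣X∣ = begin
    iH X + suc d C 2     ≡⟨ cong (_+ suc d C 2) one-edge ⟩
    1 + suc d C 2        ≡⟨ 1+suc-C2≡*2 1≤d (subst (d ≤_) ∣X∣≡2 d≤∣X∣) ⟩
    d * 2                ≡⟨ cong (d *_) ∣X∣≡2 ⟨
    d * ∣ X ∣            ∎
    where open ≡-Reasoning
  criticalSet⇒tight X (inj₂ (_ , tight)) _ = tight

  tight⇒criticalSet : ∀ X → Tight X → (∣ X ∣ ≡ 2 × d ≤ 2) ⊎ suc (suc d) ≤ ∣ X ∣ → CriticalSet X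
  tight⇒criticalSet X tight (inj₁ (∣X∣≡2 , d≤2)) = inj₁ (∣X∣≡2 , +-cancelʳ-≡ (suc d C 2) (iH X) 1 (begin
    iH X + suc d C 2     ≡⟨ tight ⟩
    d * ∣ X ∣            ≡⟨ cong (d *_) ∣X∣≡2 ⟩
    d * 2                ≡⟨ 1+suc-C2≡*2 1≤d d≤2 ⟨
    1 + suc d C 2        ∎))
    where open ≡-Reasoning
  tight⇒criticalSet X tight (inj₂ d+2≤∣X∣) = inj₂ (d+2≤∣X∣ , tight)

  components-overlap : ∀ (S T : Subgraph H) → CriticalComponent d S → CriticalComponent d T →
                       d ≤ ∣ verts S ∩ verts T ∣ → verts S ≡ verts T
  components-overlap S T compS compT d≤∣X∩Y∣ = components-merge S T compS compT
    (tight⇒criticalSet (X ∪ Y) (tight-∪ X Y tightX tightY (sparse (X ∩ Y) d≤∣X∩Y∣) d≤∣X∪Y∣) size)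
    where
    X = verts S
    Y = verts T
    critX = critical⇒criticalSet S (proj₁ compS)
    critY = critical⇒criticalSet T (proj₁ compT)
    tightX = criticalSet⇒tight X critX (≤-trans d≤∣X∩Y∣ (∣p∩q∣≤∣p∣ X Y))
    tightY = criticalSet⇒tight Y critY (≤-trans d≤∣X∩Y∣ (∣p∩q∣≤∣q∣ X Y))
    d≤∣X∪Y∣ = ≤-trans d≤∣X∩Y∣ (≤-trans (∣p∩q∣≤∣p∣ X Y) (∣p∣≤∣p∪q∣ X Y))
    size : (∣ X ∪ Y ∣ ≡ 2 × d ≤ 2) ⊎ suc (suc d) ≤ ∣ X ∪ Y ∣
    size with critX | critY
    ... | inj₂ (d+2≤∣X∣ , _) | _                 = inj₂ (≤-trans d+2≤∣X∣ (∣p∣≤∣p∪q∣ X Y))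
    ... | inj₁ _             | inj₂ (d+2≤∣Y∣ , _) = inj₂ (≤-trans d+2≤∣Y∣ (∣q∣≤∣p∪q∣ X Y))
    ... | inj₁ (∣X∣≡2 , _)    | inj₁ (∣Y∣≡2 , _)    = pair-union-size
      (trans (∣p∪q∣+∣p∩q∣≡∣p∣+∣q∣ X Y) (cong₂ _+_ ∣X∣≡2 ∣Y∣≡2)) 1≤d d≤∣X∩Y∣
      (subst (∣ X ∩ Y ∣ ≤_) ∣X∣≡2 (∣p∩q∣≤∣p∣ X Y))

  components-thin : ∀ (S T : Subgraph H) → CriticalComponent d S → CriticalComponent d T →
                    verts S ≢ verts T → ∣ verts S ∩ verts T ∣ ≤ d ∸ 1
  components-thin S T compS compT S≢T with ∣ verts S ∩ verts T ∣ ≤? d ∸ 1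
  ... | yes thin  = thin
  ... | no  ¬thin = ⊥-elim (S≢T (components-overlap S T compS compT
                      (subst (_≤ ∣ verts S ∩ verts T ∣) suc[d∸1]≡d (≰⇒> ¬thin))))
    where
    suc[d∸1]≡d : suc (d ∸ 1) ≡ d
    suc[d∸1]≡d = trans (+-comm 1 (d ∸ 1)) (m∸n+n≡m 1≤d)

  nonadjacent⇒large : ∀ X → CriticalSet X → ∀ {u v} → u ≢ v → u ∈ X → v ∈ X → adj H u v ≡ false →
                      suc (suc d) ≤ ∣ X ∣ × Tight X
  nonadjacent⇒large X (inj₂ large) _ _ _ _ = large
  nonadjacent⇒large X (inj₁ (∣X∣≡2 , one-edge)) {u} {v} u≢v u∈X v∈X ¬uv = ⊥-elim (1+n≰n (begin
    2               ≡⟨ cong suc one-edge ⟨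
    suc (iH X)      ≤⟨ iE<C2 X u≢v u∈X v∈X ¬uv (trans (SimpleGraph.sym H v u) ¬uv) ⟩
    ∣ X ∣ C 2        ≡⟨ cong (_C 2) ∣X∣≡2 ⟩
    1               ∎))
    where open ≤-Reasoning

  hinge-adjacent : ∀ (U : Subset n) → ∣ U ∣ ≡ d ∸ 1 → (S T : Subgraph H) →
                   CriticalComponent d S → CriticalComponent d T → verts S ≢ verts T →
                   U ⊆ verts S → U ⊆ verts T → ∀ {u v} → u ∈ U → v ∈ U → u ≢ v → adj H u v ≡ true
  hinge-adjacent U ∣U∣≡d-1 S T compS compT S≢T U⊆X U⊆Y {u} {v} u∈U v∈U u≢v with adj H u v in uv
  ... | true  = refl
  ... | false = ⊥-elim (S≢T (components-merge S T compS compT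
                  (tight⇒criticalSet (X ∪ Y) tightX∪Y (inj₂ (≤-trans d+2≤∣X∣ (∣p∣≤∣p∪q∣ X Y))))))
    where
    X = verts S
    Y = verts T
    largeX = nonadjacent⇒large X (critical⇒criticalSet S (proj₁ compS)) u≢v (U⊆X u∈U) (U⊆X v∈U) uv
    largeY = nonadjacent⇒large Y (critical⇒criticalSet T (proj₁ compT)) u≢v (U⊆Y u∈U) (U⊆Y v∈U) uv
    d+2≤∣X∣ = proj₁ largeX
    U⊆X∩Y : U ⊆ X ∩ Y
    U⊆X∩Y x∈U = x∈p∩q⁺ (U⊆X x∈U , U⊆Y x∈U)
    ∣X∩Y∣≡d-1 : ∣ X ∩ Y ∣ ≡ d ∸ 1
    ∣X∩Y∣≡d-1 = ≤-antisym (components-thin S T compS compT S≢T)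
                          (subst (_≤ ∣ X ∩ Y ∣) ∣U∣≡d-1 (p⊆q⇒∣p∣≤∣q∣ U⊆X∩Y))
    sparse-X∩Y : iH (X ∩ Y) + suc d C 2 ≤ d * ∣ X ∩ Y ∣
    sparse-X∩Y = subst (λ k → iH (X ∩ Y) + suc d C 2 ≤ d * k) (sym ∣X∩Y∣≡d-1) (pred-C2-slack 1≤d
      (subst (λ k → suc (iH (X ∩ Y)) ≤ k C 2) ∣X∩Y∣≡d-1
        (iE<C2 (X ∩ Y) u≢v (U⊆X∩Y u∈U) (U⊆X∩Y v∈U) uv (trans (SimpleGraph.sym H v u) uv))))
    tightX∪Y = tight-∪ X Y (proj₂ largeX) (proj₂ largeY) sparse-X∩Y
                 (≤-trans (m≤n+m d 2) (≤-trans d+2≤∣X∣ (∣p∣≤∣p∪q∣ X Y)))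

  nonedge⇒criticalSet : ∀ {u v} → u ≢ v → adj H u v ≡ false → ¬ Sparse d (addEdge (adj H) u v) →
                        ∃[ X ] CriticalSet X × u ∈ X × v ∈ X
  nonedge⇒criticalSet {u} {v} u≢v ¬uv ¬sparse with ¬Sparse⇒overfull d (addEdge (adj H) u v) ¬sparse
  ... | X , d≤∣X∣ , overfull = X , inj₂ (d+2≤∣X∣ , tight) , both-ends
    where
    c = suc d C 2
    H+uv = addEdge (adj H) u v
    deficit≤iH : d * ∣ X ∣ ∸ c ≤ iH X
    deficit≤iH = s≤s⁻¹ (≤-trans overfull (≤-trans (iE-addEdge-≤ X u≢v) (≤-reflexive (+-comm (iH X) 1))))
    tight : Tight X
    tight = ≤-antisym (sparse X d≤∣X∣) (begin
      d * ∣ X ∣             ≡⟨ m∸n+n≡m (suc-C2≤* d≤∣X∣) ⟨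
      d * ∣ X ∣ ∸ c + c     ≤⟨ +-monoˡ-≤ c deficit≤iH ⟩
      iH X + c             ∎)
      where open ≤-Reasoning
    both-ends : u ∈ X × v ∈ X
    both-ends = decidable-stable (u ∈? X ×-dec v ∈? X) λ ¬both →
      <⇒≱ overfull (≤-trans (iE-addEdge-outside X ¬both) (H-sparse X d≤∣X∣))
    d+2≤∣X∣ : suc (suc d) ≤ ∣ X ∣
    d+2≤∣X∣ with suc (suc d) ≤? ∣ X ∣
    ... | yes large = large
    ... | no  small = ⊥-elim (<⇒≱ overfull (≤-trans (iE≤C2 H+uv X)
            (m+n≤o⇒m≤o∸n (∣ X ∣ C 2) (C2+suc-C2≤* d≤∣X∣ (s≤s⁻¹ (≰⇒> small))))))

  edge⇒criticalSet : ∀ {u v} → u ≢ v → (adj H u v ≡ false → ¬ Sparse d (addEdge (adj H) u v)) →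
                     ∃[ X ] CriticalSet X × u ∈ X × v ∈ X
  edge⇒criticalSet {u} {v} u≢v saturated with adj H u v in uv
  ... | false = nonedge⇒criticalSet u≢v uv (saturated refl)
  ... | true  = ⁅ u ⁆ ∪ ⁅ v ⁆ , inj₁ (∣⁅x⁆∪⁅y⁆∣≡2 u≢v , ≤-antisym at-most-one at-least-one) ,
                x∈⁅x⁆∪⁅y⁆ u v , y∈⁅x⁆∪⁅y⁆ u v
    where
    at-most-one : iH (⁅ u ⁆ ∪ ⁅ v ⁆) ≤ 1
    at-most-one = ≤-trans (iE≤C2 (adj H) (⁅ u ⁆ ∪ ⁅ v ⁆)) (≤-reflexive (cong (_C 2) (∣⁅x⁆∪⁅y⁆∣≡2 u≢v)))
    at-least-one : 1 ≤ iH (⁅ u ⁆ ∪ ⁅ v ⁆)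
    at-least-one = edge⇒1≤iE u≢v (x∈⁅x⁆∪⁅y⁆ u v) (y∈⁅x⁆∪⁅y⁆ u v) uv (trans (SimpleGraph.sym H v u) uv)

lemma3p1 : (n d : ℕ) → 1 ≤ d → (G H : SimpleGraph n) → MaxSparseSpanning d H G →
    ((S : Subgraph H) → CriticalComponent d S → 2 ≤ ∣ verts S ∣)
    × ((u v : Fin n) → adj G u v ≡ true →
        Σ (Subgraph H) (λ S → CriticalComponent d S × (u ∈ verts S) × (v ∈ verts S)))
    × ((S T : Subgraph H) → CriticalComponent d S → CriticalComponent d T →
        ¬ (verts S ≡ verts T) → ∣ verts S ∩ verts T ∣ ≤ d ∸ 1)
    × ((U : Subset n) → ∣ U ∣ ≡ d ∸ 1 → (S T : Subgraph H) →
        CriticalComponent d S → CriticalComponent d T → ¬ (verts S ≡ verts T) →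
        U ⊆ verts S → U ⊆ verts T → Closed G U)
lemma3p1 n d 1≤d G H (H⊆G , H-sparse , saturated) =
  component-size , cover , components-thin , closed-hinge
  where
  open SparseGraph 1≤d H H-sparse
  cover : (u v : Fin n) → adj G u v ≡ true →
          Σ (Subgraph H) (λ S → CriticalComponent d S × (u ∈ verts S) × (v ∈ verts S))
  cover u v uv =
    let X , critX , u∈X , v∈X = edge⇒criticalSet (adj⇒≢ G uv) (saturated u v uv)
        S , compS , X⊆S = criticalSet⊆component X critX
    in  S , compS , X⊆S u∈X , X⊆S v∈X
  closed-hinge : (U : Subset n) → ∣ U ∣ ≡ d ∸ 1 → (S T : Subgraph H) →
                 CriticalComponent d S → CriticalComponent d T → ¬ (verts S ≡ verts T) →
                 U ⊆ verts S → U ⊆ verts T → Closed G U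
  closed-hinge U ∣U∣≡d-1 S T compS compT S≢T U⊆S U⊆T u v u∈U v∈U u≢v =
    H⊆G u v (hinge-adjacent U ∣U∣≡d-1 S T compS compT S≢T U⊆S U⊆T u∈U v∈U u≢v)
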